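{- Let $T$ be a tree with $\operatorname{diam}(T)\geq 3$ and let $T\overline{T}$ be its complementary prism. If $u,v\in V(T)$ satisfy $d_T(u,v)=3$, then $[\{u,v\}]_{T\overline{T}}=V(T\overline{T})$.
   Context: For a graph $G$ with complement $\overline{G}$, the complementary prism $G\overline{G}$ is the graph obtained from the disjoint union of $G$ and $\overline{G}$ by adding the perfect matching joining each vertex $v$ of $G$ to its copy $\overline{v}$ in $\overline{G}$. For a graph $H$ and $u,v\in V(H)$, $I_H[u,v]$ is the set of vertices on some shortest $u,v$-path in $H$. A set $S\subseteq V(H)$ is (geodesically) convex if $I_H[u,v]\subseteq S$ for all $u,v\in S$; the convex hull $[S]_H$ is the smallest convex set of $H$ containing $S$. $d_T$ denotes the distance in $T$. -}

module Defs where

open import Data.Nat using (ℕ; zero; suc; _≤_)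
open import Data.Fin using (Fin)
open import Data.Fin.Properties using (_≟_)
open import Data.Bool using (Bool; true; false; not; _∧_; T)
open import Data.Sum using (_⊎_; inj₁; inj₂)
open import Data.Product using (Σ; _×_; _,_; ∃; ∃-syntax)
open import Data.List using (List; []; _∷_)
open import Data.List.Relation.Unary.Unique.Propositional using (Unique)
open import Relation.Nullary.Decidable using (⌊_⌋)
open import Relation.Binary.PropositionalEquality using (_≡_)
open import Level using (0ℓ)

record SimpleGraph (n : ℕ) : Set where
  field
    adj    : Fin n → Fin n → Bool
    sym    : ∀ u v → adj u v ≡ adj v u
    irrefl : ∀ v → adj v v ≡ false
open SimpleGraph public

data Walk {V : Set} (A : V → V → Bool) : V → V → ℕ → Set where
  [] : ∀ {u} → Walk A u u zero
  _∷_ : ∀ {u w v k} → T (A u w) → Walk A w v k → Walk A u v (suc k)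

verts : ∀ {V : Set} {A : V → V → Bool} {u v k} → Walk A u v k → List V
verts {u = u} [] = u ∷ []
verts {u = u} (_ ∷ w) = u ∷ verts w

data OnWalk {V : Set} {A : V → V → Bool} (x : V) :
            ∀ {u v k} → Walk A u v k → Set where
  here  : ∀ {v k} (w : Walk A x v k) → OnWalk x w
  there : ∀ {u y v k} (e : T (A u y)) (w : Walk A y v k) → OnWalk x w → OnWalk x (e ∷ w)

Dist : {V : Set} → (V → V → Bool) → V → V → ℕ → Set
Dist A u v k = Walk A u v k × (∀ m → Walk A u v m → k ≤ m)

Connected : ∀ {n} → SimpleGraph n → Set
Connected G = ∀ u v → ∃[ k ] Walk (adj G) u v k

-- a cycle: a path u = x0, ..., xk = w with distinct vertices, k ≥ 2,
-- closed by the edge w u (so a cycle of length k+1 ≥ 3)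
HasCycle : ∀ {n} → SimpleGraph n → Set
HasCycle G = Σ _ λ u → Σ _ λ w → Σ ℕ λ k →
  Σ (Walk (adj G) u w k) λ p → 2 ≤ k × Unique (verts p) × T (adj G w u)

IsTree : ∀ {n} → SimpleGraph n → Set
IsTree G = Connected G × (HasCycle G → Data.Empty.⊥)
  where import Data.Empty

DiamAtLeast3 : ∀ {n} → SimpleGraph n → Set
DiamAtLeast3 G = Σ _ λ x → Σ _ λ y → Σ ℕ λ k → Dist (adj G) x y k × 3 ≤ k

-- complementary prism G Ḡ: vertices inj₁ v (copy in G), inj₂ v (copy in Ḡ)
prismAdj : ∀ {n} → SimpleGraph n → Fin n ⊎ Fin n → Fin n ⊎ Fin n → Bool
prismAdj G (inj₁ a) (inj₁ b) = adj G a b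
prismAdj G (inj₂ a) (inj₂ b) = not (adj G a b) ∧ not ⌊ a ≟ b ⌋
prismAdj G (inj₁ a) (inj₂ b) = ⌊ a ≟ b ⌋
prismAdj G (inj₂ a) (inj₁ b) = ⌊ a ≟ b ⌋

Interval : {V : Set} → (V → V → Bool) → V → V → V → Set
Interval A u v x = Σ ℕ λ k → Σ (Walk A u v k) λ p → Dist A u v k × OnWalk x p

Convex : {V : Set} → (V → V → Bool) → (V → Set) → Set
Convex A S = ∀ u v → S u → S v → ∀ x → Interval A u v x → S x

Hull : {V : Set} → (V → V → Bool) → (V → Set) → V → Set₁
Hull A S x = ∀ (C : _ → Set) → Convex A C → (∀ y → S y → C y) → C x

Pair : {V : Set} → V → V → V → Set
Pair u v x = (x ≡ u) ⊎ (x ≡ v)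

module Submission where

-- Let u – a – b – v be a shortest path (length 3) in the tree T
-- and C a convex set of the prism T T̄ containing u and v.
--   * u,v stay at distance 3 in the prism, and both u a b v and u ū v̄ v are
--     geodesics there, so C ∋ a, b, ū, v̄.
--   * v̄ – ā – a and ū – b̄ – b are geodesics (v̄ ≁ a, ū ≁ b), so C ∋ ā, b̄.
--   * Any other vertex x misses an edge of the path: it is non-adjacent to
--     both u,a or to both b,v, since otherwise T has a cycle or d(u,v) ≤ 2.
--     If x misses p,q with p ~ q, then p̄ – x̄ – q̄ is a geodesic, so C ∋ x̄.
--   * With all of T̄ inside C, an edge w ~ y carries C ∋ w to C ∋ y through the
--     geodesic ȳ – y – w; connectivity of T then gives all of V(T).

open import Defs
open import Data.Nat using (ℕ; zero; suc; _≤_; z≤n; s≤s)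
open import Data.Fin using (Fin)
open import Data.Fin.Properties using (_≟_)
open import Data.Sum using (_⊎_; inj₁; inj₂)
open import Data.Sum.Properties using (inj₂-injective)
open import Data.Product using (_×_; _,_; proj₂)
open import Data.Bool using (Bool; true; false; not; _∧_; T)
open import Data.Unit using (tt)
open import Data.Empty using (⊥; ⊥-elim)
open import Data.List using ([]; _∷_)
open import Data.List.Relation.Unary.All using ([]; _∷_)
open import Data.List.Relation.Unary.AllPairs using (AllPairs; []; _∷_)
open import Relation.Nullary using (¬_; Dec; yes; no)
open import Relation.Nullary.Decidable using (toWitness; fromWitness; T?)
open import Relation.Binary.PropositionalEquality
  using (_≡_; _≢_; refl; subst; trans; ≢-sym)

walk₀-ends-equal : ∀ {V : Set} {A : V → V → Bool} {s t} → Walk A s t 0 → s ≡ t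
walk₀-ends-equal [] = refl

walk₁-is-edge : ∀ {V : Set} {A : V → V → Bool} {s t} → Walk A s t 1 → T (A s t)
walk₁-is-edge (e ∷ []) = e

T-not : ∀ {c} → ¬ T c → T (not c)
T-not {false} _ = tt
T-not {true} ¬t = ¬t tt

T-∧ : ∀ {c d} → T c → T d → T (c ∧ d)
T-∧ {true} _ t = t

T-not-∧ : ∀ {c} d → T c → ¬ T (not c ∧ d)
T-not-∧ {true} _ _ ()

both-fail-or-one-holds : ∀ {P Q : Set} → Dec P → Dec Q → (¬ P × ¬ Q) ⊎ (P ⊎ Q)
both-fail-or-one-holds (yes p) _ = inj₂ (inj₁ p)
both-fail-or-one-holds (no ¬p) (yes q) = inj₂ (inj₂ q)
both-fail-or-one-holds (no ¬p) (no ¬q) = inj₁ (¬p , ¬q)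

module TwoStepGeodesics {V : Set} (A : V → V → Bool) where

  distance-≥2 : ∀ {s t} → s ≢ t → ¬ T (A s t) → ∀ m → Walk A s t m → 2 ≤ m
  distance-≥2 s≢t _ zero w = ⊥-elim (s≢t (walk₀-ends-equal w))
  distance-≥2 _ s≁t (suc zero) w = ⊥-elim (s≁t (walk₁-is-edge w))
  distance-≥2 _ _ (suc (suc m)) _ = s≤s (s≤s z≤n)

  middle-in-interval : ∀ {s x t} → s ≢ t → ¬ T (A s t) → T (A s x) → T (A x t) →
    Interval A s t x
  middle-in-interval s≢t s≁t sx xt =
    2 , W , (W , distance-≥2 s≢t s≁t) , there _ _ (here _)
    where
    W : Walk A _ _ 2
    W = sx ∷ xt ∷ []

  convex-middle : ∀ {C : V → Set} → Convex A C → ∀ {s x t} → C s → C t →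
    s ≢ t → ¬ T (A s t) → T (A s x) → T (A x t) → C x
  convex-middle convex cs ct s≢t s≁t sx xt =
    convex _ _ cs ct _ (middle-in-interval s≢t s≁t sx xt)

module ComplementaryPrism {n : ℕ} (G : SimpleGraph n) where

  A : Fin n → Fin n → Bool
  A = adj G

  P : Fin n ⊎ Fin n → Fin n ⊎ Fin n → Bool
  P = prismAdj G
  open TwoStepGeodesics P

  adj-sym : ∀ {p q} → T (A p q) → T (A q p)
  adj-sym {p} {q} = subst T (SimpleGraph.sym G p q)

  adj⇒≢ : ∀ {p q} → T (A p q) → p ≢ q
  adj⇒≢ {p} pp refl = subst T (irrefl G p) pp

  matching : ∀ p → T (P (inj₁ p) (inj₂ p))
  matching p = fromWitness {a? = p ≟ p} refl

  matching′ : ∀ p → T (P (inj₂ p) (inj₁ p))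
  matching′ p = fromWitness {a? = p ≟ p} refl

  cross-non-edge : ∀ {p q} → p ≢ q → ¬ T (P (inj₂ p) (inj₁ q))
  cross-non-edge {p} {q} p≢q t = p≢q (toWitness {a? = p ≟ q} t)

  complement-edge : ∀ {p q} → ¬ T (A p q) → p ≢ q → T (P (inj₂ p) (inj₂ q))
  complement-edge {p} {q} p≁q p≢q =
    T-∧ (T-not p≁q) (T-not (λ t → p≢q (toWitness {a? = p ≟ q} t)))

  complement-non-edge : ∀ {p q} → T (A p q) → ¬ T (P (inj₂ p) (inj₂ q))
  complement-non-edge pq = T-not-∧ _ pq

  -- Distances ≥ 3 in G persist in G Ḡ: a two-step detour through Ḡ would
  -- have to be p – p̄ – p.
  prism-distance-≥3 : ∀ {u v} → (∀ m → Walk A u v m → 3 ≤ m) →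
    ∀ m → Walk P (inj₁ u) (inj₁ v) m → 3 ≤ m
  prism-distance-≥3 far (suc (suc zero)) (_∷_ {w = inj₁ y} uy yv) =
    far 2 (uy ∷ walk₁-is-edge yv ∷ [])
  prism-distance-≥3 {u} {v} far (suc (suc zero)) (_∷_ {w = inj₂ y} uy yv)
    with trans (toWitness {a? = u ≟ y} uy) (toWitness {a? = y ≟ v} (walk₁-is-edge yv))
  ... | refl with far 0 []
  ...   | ()
  prism-distance-≥3 far zero w with walk₀-ends-equal w
  ... | refl = far 0 []
  prism-distance-≥3 far (suc zero) w = far 1 (walk₁-is-edge w ∷ [])
  prism-distance-≥3 far (suc (suc (suc m))) _ = s≤s (s≤s (s≤s z≤n))

  module _ {C : Fin n ⊎ Fin n → Set} (convex : Convex P C) where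

    -- If x misses both ends of an edge p ~ q, then p̄ – x̄ – q̄ is a geodesic.
    complement-middle : ∀ {p q x} → T (A p q) →
      ¬ T (A p x) → p ≢ x → ¬ T (A x q) → x ≢ q →
      C (inj₂ p) → C (inj₂ q) → C (inj₂ x)
    complement-middle pq p≁x p≢x x≁q x≢q cp cq =
      convex-middle convex cp cq (λ eq → adj⇒≢ pq (inj₂-injective eq))
        (complement-non-edge pq) (complement-edge p≁x p≢x) (complement-edge x≁q x≢q)

    -- Once C contains Ḡ, an edge w ~ y of G carries w ∈ C to y ∈ C
    -- along the geodesic ȳ – y – w.
    copy-step : (∀ x → C (inj₂ x)) → ∀ {w y} → T (A w y) → C (inj₁ w) → C (inj₁ y)
    copy-step complement wy cw =
      convex-middle convex (complement _) cw (λ ()) (cross-non-edge (≢-sym (adj⇒≢ wy)))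
        (matching′ _) (adj-sym wy)

    copy-along-walk : (∀ x → C (inj₂ x)) → ∀ {w y k} → Walk A w y k →
      C (inj₁ w) → C (inj₁ y)
    copy-along-walk complement [] cw = cw
    copy-along-walk complement (e ∷ rest) cw =
      copy-along-walk complement rest (copy-step complement e cw)

    copy-connected : Connected G → (∀ x → C (inj₂ x)) → ∀ {w} → C (inj₁ w) → ∀ x → C x
    copy-connected connected complement {w} cw (inj₁ y) =
      copy-along-walk complement (proj₂ (connected w y)) cw
    copy-connected connected complement cw (inj₂ y) = complement y

module PathOfLength3 {n : ℕ} (G : SimpleGraph n) (acyclic : HasCycle G → ⊥)
  {u a b v : Fin n} (ua : T (adj G u a)) (ab : T (adj G a b)) (bv : T (adj G b v))
  (far : ∀ m → Walk (adj G) u v m → 3 ≤ m) where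

  open ComplementaryPrism G using (A; adj-sym; adj⇒≢)

  u≢v : u ≢ v
  u≢v refl with far 0 []
  ... | ()

  u≁v : ¬ T (A u v)
  u≁v uv with far 1 (uv ∷ [])
  ... | s≤s ()

  u≁b : ¬ T (A u b)
  u≁b ub with far 2 (ub ∷ bv ∷ [])
  ... | s≤s (s≤s ())

  a≁v : ¬ T (A a v)
  a≁v av with far 2 (ua ∷ av ∷ [])
  ... | s≤s (s≤s ())

  u≢b : u ≢ b
  u≢b refl = u≁v bv

  a≢v : a ≢ v
  a≢v refl = u≁v ua

  -- A vertex off the path cannot see both {u,a} and {b,v}: the four ways of
  -- doing so give the cycles u a b x, a b x, a b v x, or the short path u x v.
  no-bridge : ∀ {x} → x ≢ u → x ≢ a → x ≢ b → x ≢ v →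
    T (A x u) ⊎ T (A x a) → T (A x b) ⊎ T (A x v) → ⊥
  no-bridge {x} x≢u x≢a x≢b _ (inj₁ xu) (inj₁ xb) =
    acyclic (_ , _ , 3 , (ua ∷ ab ∷ adj-sym xb ∷ []) , s≤s (s≤s z≤n) , distinct , xu)
    where
    distinct : AllPairs _≢_ (u ∷ a ∷ b ∷ x ∷ [])
    distinct = (adj⇒≢ ua ∷ u≢b ∷ ≢-sym x≢u ∷ []) ∷ (adj⇒≢ ab ∷ ≢-sym x≢a ∷ [])
               ∷ (≢-sym x≢b ∷ []) ∷ [] ∷ []
  no-bridge _ _ _ _ (inj₁ xu) (inj₂ xv) with far 2 (adj-sym xu ∷ xv ∷ [])
  ... | s≤s (s≤s ())
  no-bridge {x} _ x≢a x≢b _ (inj₂ xa) (inj₁ xb) =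
    acyclic (_ , _ , 2 , (ab ∷ adj-sym xb ∷ []) , s≤s (s≤s z≤n) , distinct , xa)
    where
    distinct : AllPairs _≢_ (a ∷ b ∷ x ∷ [])
    distinct = (adj⇒≢ ab ∷ ≢-sym x≢a ∷ []) ∷ (≢-sym x≢b ∷ []) ∷ [] ∷ []
  no-bridge {x} _ x≢a x≢b x≢v (inj₂ xa) (inj₂ xv) =
    acyclic (_ , _ , 3 , (ab ∷ bv ∷ adj-sym xv ∷ []) , s≤s (s≤s z≤n) , distinct , xa)
    where
    distinct : AllPairs _≢_ (a ∷ b ∷ v ∷ x ∷ [])
    distinct = (adj⇒≢ ab ∷ a≢v ∷ ≢-sym x≢a ∷ []) ∷ (adj⇒≢ bv ∷ ≢-sym x≢b ∷ [])
               ∷ (≢-sym x≢v ∷ []) ∷ [] ∷ []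

  misses-an-end-edge : ∀ x → x ≢ u → x ≢ a → x ≢ b → x ≢ v →
    (¬ T (A x u) × ¬ T (A x a)) ⊎ (¬ T (A x b) × ¬ T (A x v))
  misses-an-end-edge x x≢u x≢a x≢b x≢v
    with both-fail-or-one-holds (T? (A x u)) (T? (A x a))
       | both-fail-or-one-holds (T? (A x b)) (T? (A x v))
  ... | inj₁ misses-ua | _ = inj₁ misses-ua
  ... | inj₂ _ | inj₁ misses-bv = inj₂ misses-bv
  ... | inj₂ sees-ua | inj₂ sees-bv = ⊥-elim (no-bridge x≢u x≢a x≢b x≢v sees-ua sees-bv)

module HullOfDistance3Pair {n : ℕ} (G : SimpleGraph n) (acyclic : HasCycle G → ⊥)
  {u a b v : Fin n} (ua : T (adj G u a)) (ab : T (adj G a b)) (bv : T (adj G b v))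
  (far : ∀ m → Walk (adj G) u v m → 3 ≤ m)
  {C : Fin n ⊎ Fin n → Set} (convex : Convex (prismAdj G) C)
  (cu : C (inj₁ u)) (cv : C (inj₁ v)) where

  open ComplementaryPrism G
  open TwoStepGeodesics P using (convex-middle)
  open PathOfLength3 G acyclic ua ab bv far

  on-geodesic : (W : Walk P (inj₁ u) (inj₁ v) 3) → ∀ {x} → OnWalk x W → C x
  on-geodesic W onW = convex _ _ cu cv _ (3 , W , (W , prism-distance-≥3 far) , onW)

  path-in-G : Walk P (inj₁ u) (inj₁ v) 3
  path-in-G = _∷_ {w = inj₁ a} ua (_∷_ {w = inj₁ b} ab (bv ∷ []))

  path-via-Ḡ : Walk P (inj₁ u) (inj₁ v) 3
  path-via-Ḡ = _∷_ {w = inj₂ u} (matching u)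
               (_∷_ {w = inj₂ v} (complement-edge u≁v u≢v) (matching′ v ∷ []))

  ca : C (inj₁ a)
  ca = on-geodesic path-in-G (there _ _ (here _))

  cb : C (inj₁ b)
  cb = on-geodesic path-in-G (there _ _ (there _ _ (here _)))

  cū : C (inj₂ u)
  cū = on-geodesic path-via-Ḡ (there _ _ (here _))

  cv̄ : C (inj₂ v)
  cv̄ = on-geodesic path-via-Ḡ (there _ _ (there _ _ (here _)))

  -- ā lies on the geodesic v̄ – ā – a, and b̄ on ū – b̄ – b.
  cā : C (inj₂ a)
  cā = convex-middle convex cv̄ ca (λ ()) (cross-non-edge (≢-sym a≢v))
         (complement-edge (λ va → a≁v (adj-sym va)) (≢-sym a≢v)) (matching′ a)

  cb̄ : C (inj₂ b)
  cb̄ = convex-middle convex cū cb (λ ()) (cross-non-edge u≢b)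
         (complement-edge u≁b u≢b) (matching′ b)

  complement : ∀ x → C (inj₂ x)
  complement x with x ≟ u | x ≟ a | x ≟ b | x ≟ v
  ... | yes refl | _ | _ | _ = cū
  ... | no _ | yes refl | _ | _ = cā
  ... | no _ | no _ | yes refl | _ = cb̄
  ... | no _ | no _ | no _ | yes refl = cv̄
  ... | no x≢u | no x≢a | no x≢b | no x≢v with misses-an-end-edge x x≢u x≢a x≢b x≢v
  ...   | inj₁ (x≁u , x≁a) =
    complement-middle convex ua (λ ux → x≁u (adj-sym ux)) (≢-sym x≢u) x≁a x≢a cū cā
  ...   | inj₂ (x≁b , x≁v) =
    complement-middle convex bv (λ bx → x≁b (adj-sym bx)) (≢-sym x≢b) x≁v x≢v cb̄ cv̄

lemma3p2 : ∀ {n : ℕ} (G : SimpleGraph n) → IsTree G → DiamAtLeast3 G →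
    (u v : Fin n) → Dist (adj G) u v 3 →
    ∀ (x : Fin n ⊎ Fin n) → Hull (prismAdj G) (Pair (inj₁ u) (inj₁ v)) x
lemma3p2 G (connected , acyclic) _ u v (ua ∷ ab ∷ bv ∷ [] , far) x C convex ⊇pair =
  ComplementaryPrism.copy-connected G convex connected
    (HullOfDistance3Pair.complement G acyclic ua ab bv far convex cu cv) cu x
  where
  cu : C (inj₁ u)
  cu = ⊇pair _ (inj₁ refl)
  cv : C (inj₁ v)
  cv = ⊇pair _ (inj₂ refl)
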